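{- Let $k\ge 2$. For $1\le i\le k$ let $\mu_{k,i}$ be the unique partition whose $\beta$-set is $$\gamma_{k,i}=\{2a-1+(s-1)(2k+3)\mid 1\le s\le k,\ 1\le a\le k+1-s\}\cup\{2k+2+p(2k+3)\mid 0\le p\le i-1\}.$$ Then $|\mu_{k,i}|\le|\mu_{k,k}|$ for all $1\le i\le k$, with equality if and only if $i=k$.
   Context: A partition is a weakly decreasing finite sequence of positive integers; $|\mu|$ denotes its size (sum of parts). The $\beta$-set of a partition is the set of hook lengths of the boxes in the first column of its Young diagram; if $h_1>\dots>h_m$ are positive integers, the unique partition with $\beta$-set $\{h_1,\dots,h_m\}$ is $(h_1-(m-1),h_2-(m-2),\dots,h_{m-1}-1,h_m)$, whose size is $\sum_{j=1}^m h_j-\binom{m}{2}$. -}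

module Defs where

open import Data.Nat using (ℕ; zero; suc; _+_; _*_; _∸_)
open import Data.Nat.Properties using (≤-decTotalOrder)
open import Data.Nat.ListAction using (sum)
open import Data.List using (List; []; _∷_; _++_; map; concatMap; upTo; length; applyUpTo; reverse)
import Data.List.Sort

-- A partition is represented as a (weakly decreasing) list of positive parts.
Partition : Set
Partition = List ℕ

size : Partition → ℕ
size = sum

open Data.List.Sort ≤-decTotalOrder using () renaming (sort to sortAsc)

sortDesc : List ℕ → List ℕ
sortDesc xs = reverse (sortAsc xs)

fromDecreasingBeta : List ℕ → Partition
fromDecreasingBeta [] = []
fromDecreasingBeta (h ∷ hs) = (h ∸ length hs) ∷ fromDecreasingBeta hs

partitionOfBetaSet : List ℕ → Partition
partitionOfBetaSet β = fromDecreasingBeta (sortDesc β)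

-- γ_{k,i} = { 2a-1+(s-1)(2k+3) | 1≤s≤k, 1≤a≤k+1-s } ∪ { 2k+2+p(2k+3) | 0≤p≤i-1 }
-- Indices: s = s' + 1 with s' < k, a = a' + 1 with a' < k - s'; p < i.
gamma : ℕ → ℕ → List ℕ
gamma k i =
  concatMap (λ s' → applyUpTo (λ a' → 2 * (a' + 1) ∸ 1 + s' * (2 * k + 3)) (k ∸ s')) (upTo k)
  ++ applyUpTo (λ p → 2 * k + 2 + p * (2 * k + 3)) i

mu : ℕ → ℕ → Partition
mu k i = partitionOfBetaSet (gamma k i)

module Submission where

open import Defs
open import Data.Nat using (ℕ; _≤_; _<_)
open import Data.Product using (_×_)
open import Relation.Binary.PropositionalEquality using (_≡_)
open import Function.Bundles using (_⇔_)

-- For a β-set β of m distinct positive integers the associated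
-- partition has size  Σβ − tri m,  where tri m = m(m−1)/2.  The β-set γ_{k,i}
-- consists of a "staircase" S_k of m = tri (k+1) elements that does not depend
-- on i, followed by the arithmetic progression 2k+2 + p(2k+3), p < i; all its
-- elements are distinct because they occupy distinct positions r + q(2k+3),
-- 0 ≤ r < 2k+3, of an abacus with 2k+3 runners.  Summing the progression gives
--     |μ_{k,n}| + tri m + m·n  =  ΣS_k + (2k+2)·tri (n+1),
-- and doubling (2·tri (n+1) = n(n+1), 2m = k(k+1)) turns this into a quadratic
-- identity in n.  Comparing n = i and n = k = i + j yields
--     2|μ_{k,k}| = 2|μ_{k,i}| + (k+1)·j·(3i+j+2),
-- from which the inequality and the equality case i = k are immediate.

open import Data.Nat using (zero; suc; _+_; _*_; _∸_; _>_; z≤n; s≤s; z<s)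
open import Data.Nat.Properties
open import Data.Nat.ListAction using (sum)
open import Data.Nat.ListAction.Properties using (sum-++; sum-↭)
open import Data.Nat.Tactic.RingSolver using (solve-∀)
open import Data.List using (List; []; _∷_; _++_; [_]; map; concatMap; upTo; length; applyUpTo; reverse)
open import Data.List.Properties using (length-++; length-applyUpTo; unfold-reverse; map-applyUpTo; map-cong; applyUpTo-∷ʳ)
open import Data.List.Relation.Unary.All as All using (All; []; _∷_)
import Data.List.Relation.Unary.All.Properties as AllP
open import Data.List.Relation.Unary.AllPairs as AP using (AllPairs; []; _∷_)
import Data.List.Relation.Unary.AllPairs.Properties as APP
open import Data.List.Relation.Unary.Unique.Propositional using (Unique)
open import Data.List.Relation.Unary.Linked.Properties using (Linked⇒AllPairs)
open import Data.List.Relation.Binary.Permutation.Propositional using (_↭_; ↭-sym; ↭-trans; ↭⇒↭ₛ)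
open import Data.List.Relation.Binary.Permutation.Propositional.Properties using (All-resp-↭; ↭-length; ↭-reverse)
open import Data.List.Relation.Binary.Permutation.Setoid.Properties using (Unique-resp-↭)
import Data.List.Sort
open Data.List.Sort ≤-decTotalOrder using (sort; sort-↗; sort-↭)
open import Data.Product using (_,_; proj₁; proj₂; uncurry)
open import Function using (_∘_; id)
open import Function.Bundles using (mk⇔)
open import Relation.Binary.Definitions using (tri<; tri≈; tri>)
open import Relation.Binary.PropositionalEquality using (refl; sym; trans; cong; cong₂; subst; _≢_; setoid; module ≡-Reasoning)
open import Relation.Nullary using (contradiction)

open ≡-Reasoning

tri : ℕ → ℕ
tri zero    = 0
tri (suc n) = n + tri n

-- Splitting the range [0, m + n) into [0, m) and [m, m + n).
tri-+ : ∀ m n → tri (m + n) ≡ tri m + tri n + m * n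
tri-+ zero    n = sym (+-identityʳ (tri n))
tri-+ (suc m) n = begin
  m + n + tri (m + n)              ≡⟨ cong (m + n +_) (tri-+ m n) ⟩
  m + n + (tri m + tri n + m * n)  ≡⟨ regroup m n (tri m) (tri n) ⟩
  m + tri m + tri n + (n + m * n)  ∎
  where
  regroup : ∀ m n a b → m + n + (a + b + m * n) ≡ m + a + b + (n + m * n)
  regroup = solve-∀

twice-tri-suc : ∀ n → 2 * tri (suc n) ≡ n * (n + 1)
twice-tri-suc zero    = refl
twice-tri-suc (suc n) = begin
  2 * (suc n + tri (suc n))        ≡⟨ *-distribˡ-+ 2 (suc n) (tri (suc n)) ⟩
  2 * suc n + 2 * tri (suc n)      ≡⟨ cong (2 * suc n +_) (twice-tri-suc n) ⟩
  2 * suc n + n * (n + 1)          ≡⟨ expand n ⟩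
  suc n * (suc n + 1)              ∎
  where
  expand : ∀ n → 2 * suc n + n * (n + 1) ≡ suc n * (suc n + 1)
  expand = solve-∀

-- In a strictly decreasing list of naturals the head bounds the length of
-- the tail, so the subtractions in fromDecreasingBeta are exact.
tail-length≤head : ∀ {h hs} → AllPairs _>_ (h ∷ hs) → length hs ≤ h
tail-length≤head {hs = []}     _                          = z≤n
tail-length≤head {hs = _ ∷ _} ((h>h′ ∷ _) ∷ decreasing) =
  ≤-trans (s≤s (tail-length≤head decreasing)) h>h′

size-fromDecreasingBeta : ∀ {hs} → AllPairs _>_ hs →
  size (fromDecreasingBeta hs) + tri (length hs) ≡ sum hs
size-fromDecreasingBeta {[]}     []                    = refl
size-fromDecreasingBeta {h ∷ hs} decreasing@(_ ∷ rest) = begin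
  h ∸ n + μ + (n + tri n)    ≡⟨ +-interchange (h ∸ n) μ n (tri n) ⟩
  (h ∸ n + n) + (μ + tri n)  ≡⟨ cong₂ _+_ (m∸n+n≡m (tail-length≤head decreasing))
                                          (size-fromDecreasingBeta rest) ⟩
  h + sum hs                 ∎
  where
  n = length hs
  μ = size (fromDecreasingBeta hs)
  +-interchange : ∀ a b c d → a + b + (c + d) ≡ a + c + (b + d)
  +-interchange = solve-∀

reverse-decreasing : ∀ {xs} → AllPairs _<_ xs → AllPairs _>_ (reverse xs)
reverse-decreasing [] = []
reverse-decreasing {x ∷ xs} (x<xs ∷ increasing) rewrite unfold-reverse x xs =
  APP.++⁺ (reverse-decreasing increasing) ([] ∷ [])
    (All.map (λ x<y → x<y ∷ []) (All-resp-↭ (↭-sym (↭-reverse xs)) x<xs))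

sortDesc-decreasing : ∀ {xs} → Unique xs → AllPairs _>_ (sortDesc xs)
sortDesc-decreasing {xs} distinct =
  reverse-decreasing (AP.zipWith (uncurry ≤∧≢⇒<) (sorted , sorted-distinct))
  where
  sorted = Linked⇒AllPairs ≤-trans (sort-↗ xs)
  sorted-distinct = Unique-resp-↭ (setoid ℕ) (↭⇒↭ₛ (↭-sym (sort-↭ xs))) distinct

sortDesc-↭ : ∀ xs → sortDesc xs ↭ xs
sortDesc-↭ xs = ↭-trans (↭-reverse (sort xs)) (sort-↭ xs)

size-partitionOfBetaSet : ∀ {β} → Unique β →
  size (partitionOfBetaSet β) + tri (length β) ≡ sum β
size-partitionOfBetaSet {β} distinct = begin
  μ + tri (length β)            ≡⟨ cong (λ ℓ → μ + tri ℓ) (sym (↭-length (sortDesc-↭ β))) ⟩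
  μ + tri (length (sortDesc β)) ≡⟨ size-fromDecreasingBeta (sortDesc-decreasing distinct) ⟩
  sum (sortDesc β)              ≡⟨ sum-↭ (sortDesc-↭ β) ⟩
  sum β                         ∎
  where μ = size (partitionOfBetaSet β)

sum-applyUpTo-suc : ∀ (f : ℕ → ℕ) n → sum (applyUpTo f (suc n)) ≡ sum (applyUpTo f n) + f n
sum-applyUpTo-suc f n = begin
  sum (applyUpTo f (suc n))        ≡⟨ cong sum (sym (applyUpTo-∷ʳ f n)) ⟩
  sum (applyUpTo f n ++ [ f n ])   ≡⟨ sum-++ (applyUpTo f n) [ f n ] ⟩
  sum (applyUpTo f n) + (f n + 0)  ≡⟨ cong (sum (applyUpTo f n) +_) (+-identityʳ (f n)) ⟩
  sum (applyUpTo f n) + f n        ∎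

sum-arithmetic : ∀ a d n → sum (applyUpTo (λ p → a + p * d) n) ≡ n * a + tri n * d
sum-arithmetic a d zero    = refl
sum-arithmetic a d (suc n) = begin
  sum (applyUpTo term (suc n))        ≡⟨ sum-applyUpTo-suc term n ⟩
  sum (applyUpTo term n) + term n     ≡⟨ cong (_+ term n) (sum-arithmetic a d n) ⟩
  n * a + tri n * d + (a + n * d)     ≡⟨ regroup a d n (tri n) ⟩
  suc n * a + (n + tri n) * d         ∎
  where
  term : ℕ → ℕ
  term p = a + p * d
  regroup : ∀ a d n t → n * a + t * d + (a + n * d) ≡ suc n * a + (n + t) * d
  regroup = solve-∀

sum-countdown : ∀ n → sum (applyUpTo (n ∸_) n) ≡ tri (suc n)
sum-countdown zero    = refl
sum-countdown (suc n) = cong (suc n +_) (sum-countdown n)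

length-concatMap : ∀ {A B : Set} (f : A → List B) xs →
  length (concatMap f xs) ≡ sum (map (length ∘ f) xs)
length-concatMap f []       = refl
length-concatMap f (x ∷ xs) =
  trans (length-++ (f x)) (cong (length (f x) +_) (length-concatMap f xs))

-- Abacus positions: x + s·N with residue x < N lies on runner x, row s.
-- A lower row lies entirely below a higher one.
position-< : ∀ {x y s t N} → x < N → s < t → x + s * N < y + t * N
position-< {x} {y} {s} {t} {N} x<N s<t =
  <-≤-trans (+-monoˡ-< (s * N) x<N)                -- x + s·N < N + s·N = (s+1)·N
    (≤-trans (*-monoˡ-≤ N s<t) (m≤n+m (t * N) y))  -- (s+1)·N ≤ t·N ≤ y + t·N

position-injective : ∀ {x y s t N} → x < N → y < N → x + s * N ≡ y + t * N → x ≡ y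
position-injective {x} {y} {s} {t} {N} x<N y<N eq with <-cmp s t
... | tri< s<t _ _ = contradiction eq (<⇒≢ (position-< x<N s<t))
... | tri≈ _ refl _ = +-cancelʳ-≡ (s * N) x y eq
... | tri> _ _ t<s = contradiction (sym eq) (<⇒≢ (position-< y<N t<s))

-- The element
-- 2a − 1 + (s − 1)(2k + 3) of the paper is oddRunner a′ + s′ · modulus k
-- with a′ = a − 1, s′ = s − 1.
modulus : ℕ → ℕ
modulus k = 2 * k + 3

oddRunner : ℕ → ℕ
oddRunner a = 2 * (a + 1) ∸ 1

row : ℕ → ℕ → List ℕ
row k s = applyUpTo (λ a → oddRunner a + s * modulus k) (k ∸ s)

staircase : ℕ → List ℕ
staircase k = concatMap (row k) (upTo k)

lastRunner : ℕ → ℕ → List ℕ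
lastRunner k i = applyUpTo (λ p → 2 * k + 2 + p * modulus k) i

-- Closed form of the odd runner, free of truncated subtraction.
oddRunner≡ : ∀ a → oddRunner a ≡ suc (2 * a)
oddRunner≡ a = cong (_∸ 1) (distribute a)
  where
  distribute : ∀ a → 2 * (a + 1) ≡ 2 + 2 * a
  distribute = solve-∀

oddRunner-< : ∀ {a b} → a < b → oddRunner a < oddRunner b
oddRunner-< {a} {b} a<b rewrite oddRunner≡ a | oddRunner≡ b = s≤s (*-monoʳ-< 2 a<b)

oddRunner<lastRunner : ∀ {a k} → a < k → oddRunner a < 2 * k + 2
oddRunner<lastRunner {a} {k} a<k rewrite oddRunner≡ a =
  subst (_≤ 2 * k + 2) (*-suc 2 a) (≤-trans (*-monoʳ-≤ 2 a<k) (m≤m+n (2 * k) 2))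

lastRunner<modulus : ∀ k → 2 * k + 2 < modulus k
lastRunner<modulus k = +-monoʳ-< (2 * k) (n<1+n 2)

oddRunner<modulus : ∀ {a k s} → a < k ∸ s → oddRunner a < modulus k
oddRunner<modulus {k = k} {s} a<k∸s =
  <-trans (oddRunner<lastRunner (≤-trans a<k∸s (m∸n≤m k s))) (lastRunner<modulus k)

staircase-increasing : ∀ k → AllPairs _<_ (staircase k)
staircase-increasing k = APP.concat⁺ rows-increasing rows-ordered
  where
  rows-increasing : All (AllPairs _<_) (map (row k) (upTo k))
  rows-increasing = AllP.map⁺ (AllP.applyUpTo⁺₂ id k (λ s →
    APP.applyUpTo⁺₁ _ (k ∸ s) (λ a<b _ → +-monoˡ-< (s * modulus k) (oddRunner-< a<b))))
  rows-ordered : AllPairs (λ xs ys → All (λ x → All (x <_) ys) xs) (map (row k) (upTo k))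
  rows-ordered = APP.map⁺ (APP.applyUpTo⁺₁ id k (λ {s} {t} s<t _ →
    AllP.applyUpTo⁺₁ _ (k ∸ s) (λ a<k∸s →
      AllP.applyUpTo⁺₂ _ (k ∸ t) (λ _ → position-< (oddRunner<modulus {k = k} {s} a<k∸s) s<t))))

lastRunner-increasing : ∀ k i → AllPairs _<_ (lastRunner k i)
lastRunner-increasing k i = APP.applyUpTo⁺₁ _ i (λ p<q _ → position-< (lastRunner<modulus k) p<q)

-- Staircase elements sit on odd runners, so they avoid the last runner.
staircase-avoids-lastRunner : ∀ k i → All (λ x → All (x ≢_) (lastRunner k i)) (staircase k)
staircase-avoids-lastRunner k i = AllP.concat⁺ (AllP.map⁺ (AllP.applyUpTo⁺₂ id k (λ s →
  AllP.applyUpTo⁺₁ _ (k ∸ s) (λ a<k∸s → AllP.applyUpTo⁺₂ _ i (λ p same-position →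
    <⇒≢ (oddRunner<lastRunner (≤-trans a<k∸s (m∸n≤m k s)))
        (position-injective {s = s} {t = p} (oddRunner<modulus {k = k} {s} a<k∸s) (lastRunner<modulus k)
                            same-position))))))

gamma-unique : ∀ k i → Unique (gamma k i)
gamma-unique k i = APP.++⁺ (AP.map <⇒≢ (staircase-increasing k))
                           (AP.map <⇒≢ (lastRunner-increasing k i))
                           (staircase-avoids-lastRunner k i)

length-staircase : ∀ k → length (staircase k) ≡ tri (suc k)
length-staircase k = begin
  length (staircase k)                       ≡⟨ length-concatMap (row k) (upTo k) ⟩
  sum (map (length ∘ row k) (upTo k))        ≡⟨ cong sum (map-cong (λ s → length-applyUpTo _ (k ∸ s)) (upTo k)) ⟩
  sum (map (k ∸_) (upTo k))                  ≡⟨ cong sum (map-applyUpTo id (k ∸_) k) ⟩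
  sum (applyUpTo (k ∸_) k)                   ≡⟨ sum-countdown k ⟩
  tri (suc k)                                ∎

-- This is the β-set formula after splitting tri (m + n) and summing the
-- progression on the last runner; the tri n terms cancel.
size-mu : ∀ k n → let m = tri (suc k) in
  size (mu k n) + tri m + m * n ≡ sum (staircase k) + (2 * k + 2) * tri (suc n)
size-mu k n = +-cancelʳ-≡ (tri n) _ _ (begin
  μ + tri m + m * n + tri n                     ≡⟨ regroup μ (tri m) (tri n) (m * n) ⟩
  μ + (tri m + tri n + m * n)                   ≡⟨ cong (μ +_) (sym (tri-+ m n)) ⟩
  μ + tri (m + n)                               ≡⟨ cong (λ ℓ → μ + tri ℓ) (sym length-gamma) ⟩
  μ + tri (length (gamma k n))                  ≡⟨ size-partitionOfBetaSet (gamma-unique k n) ⟩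
  sum (gamma k n)                               ≡⟨ sum-gamma ⟩
  S + (n * (2 * k + 2) + tri n * modulus k)     ≡⟨ collect S n k (tri n) ⟩
  S + (2 * k + 2) * (n + tri n) + tri n         ∎)
  where
  m = tri (suc k)
  μ = size (mu k n)
  S = sum (staircase k)
  length-gamma : length (gamma k n) ≡ m + n
  length-gamma = trans (length-++ (staircase k))
                       (cong₂ _+_ (length-staircase k) (length-applyUpTo _ n))
  sum-gamma : sum (gamma k n) ≡ S + (n * (2 * k + 2) + tri n * modulus k)
  sum-gamma = trans (sum-++ (staircase k) (lastRunner k n))
                    (cong (S +_) (sum-arithmetic (2 * k + 2) (modulus k) n))
  regroup : ∀ a b c d → a + b + d + c ≡ a + (b + c + d)
  regroup = solve-∀
  collect : ∀ S n k t → S + (n * (2 * k + 2) + t * (2 * k + 3)) ≡ S + (2 * k + 2) * (n + t) + t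
  collect = solve-∀

doubled-size-mu : ∀ k n →
  2 * size (mu k n) + 2 * tri (tri (suc k)) + suc k * (n * k)
    ≡ 2 * sum (staircase k) + suc k * (2 * (n * (n + 1)))
doubled-size-mu k n = begin
  2 * μ + 2 * tri m + suc k * (n * k)          ≡⟨ reorder μ (tri m) n k ⟩
  2 * μ + 2 * tri m + k * (k + 1) * n          ≡⟨ cong (λ z → 2 * μ + 2 * tri m + z * n) (sym (twice-tri-suc k)) ⟩
  2 * μ + 2 * tri m + 2 * m * n                ≡⟨ factor μ (tri m) m n ⟩
  2 * (μ + tri m + m * n)                      ≡⟨ cong (2 *_) (size-mu k n) ⟩
  2 * (S + (2 * k + 2) * tri (suc n))          ≡⟨ expand S k (tri (suc n)) ⟩
  2 * S + suc k * (2 * (2 * tri (suc n)))      ≡⟨ cong (λ z → 2 * S + suc k * (2 * z)) (twice-tri-suc n) ⟩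
  2 * S + suc k * (2 * (n * (n + 1)))          ∎
  where
  m = tri (suc k)
  μ = size (mu k n)
  S = sum (staircase k)
  reorder : ∀ μ t n k → 2 * μ + 2 * t + suc k * (n * k) ≡ 2 * μ + 2 * t + k * (k + 1) * n
  reorder = solve-∀
  factor : ∀ μ t m n → 2 * μ + 2 * t + 2 * m * n ≡ 2 * (μ + t + m * n)
  factor = solve-∀
  expand : ∀ S k T → 2 * (S + (2 * k + 2) * T) ≡ 2 * S + suc k * (2 * (2 * T))
  expand = solve-∀

-- Pure algebra: subtracting the doubled identities at n = i and n = i + j
-- leaves the gap c·j·(3i + j + 2) between 2y and 2x.
quadratic-gap : ∀ x y c t s i j →
  2 * x + t + c * (i * (i + j)) ≡ s + c * (2 * (i * (i + 1))) →
  2 * y + t + c * ((i + j) * (i + j)) ≡ s + c * (2 * ((i + j) * (i + j + 1))) →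
  2 * y ≡ 2 * x + c * (j * suc (suc (3 * i + j)))
quadratic-gap x y c t s i j at-i at-k = +-cancelʳ-≡ Q _ _ (begin
  2 * y + Q                                  ≡⟨ split-y y t c i j ⟩
  (2 * y + t + c * (k * k)) + c * sq i       ≡⟨ cong (_+ c * sq i) at-k ⟩
  s + c * sq k + c * sq i                    ≡⟨ swap s (c * sq k) (c * sq i) ⟩
  s + c * sq i + c * sq k                    ≡⟨ cong (_+ c * sq k) (sym at-i) ⟩
  (2 * x + t + c * (i * k)) + c * sq k       ≡⟨ split-x x t c i j ⟩
  2 * x + c * (j * suc (suc (3 * i + j))) + Q ∎)
  where
  k = i + j
  sq : ℕ → ℕ
  sq n = 2 * (n * (n + 1))
  Q = t + c * (k * k) + c * sq i
  split-y : ∀ y t c i j → 2 * y + (t + c * ((i + j) * (i + j)) + c * (2 * (i * (i + 1))))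
              ≡ 2 * y + t + c * ((i + j) * (i + j)) + c * (2 * (i * (i + 1)))
  split-y = solve-∀
  swap : ∀ a b c → a + b + c ≡ a + c + b
  swap = solve-∀
  split-x : ∀ x t c i j → 2 * x + t + c * (i * (i + j)) + c * (2 * ((i + j) * (i + j + 1)))
              ≡ 2 * x + c * (j * suc (suc (3 * i + j)))
                + (t + c * ((i + j) * (i + j)) + c * (2 * (i * (i + 1))))
  split-x = solve-∀

size-difference : ∀ k i j → i + j ≡ k →
  2 * size (mu k k) ≡ 2 * size (mu k i) + suc k * (j * suc (suc (3 * i + j)))
size-difference .(i + j) i j refl =
  quadratic-gap (size (mu k i)) (size (mu k k)) (suc k) (2 * tri (tri (suc k)))
                (2 * sum (staircase k)) i j (doubled-size-mu k i) (doubled-size-mu k k)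
  where k = i + j

gap-conclusion : ∀ {x y} c j d → 2 * y ≡ 2 * x + suc c * (j * suc d) → x ≤ y × (x ≡ y → j ≡ 0)
gap-conclusion {x} c zero d gap =
  *-cancelˡ-≤ 2 (subst (2 * x ≤_) (sym gap) (m≤m+n (2 * x) _)) , λ _ → refl
gap-conclusion {x} {y} c (suc j) d gap = <⇒≤ x<y , λ x≡y → contradiction x≡y (<⇒≢ x<y)
  where
  x<y : x < y
  x<y = *-cancelˡ-< 2 x y (subst (2 * x <_) (sym gap) (m<m+n (2 * x) z<s))

lemma15 : (k : ℕ) → 2 ≤ k → (i : ℕ) → 1 ≤ i → i ≤ k →
    (size (mu k i) ≤ size (mu k k)) × ((size (mu k i) ≡ size (mu k k)) ⇔ (i ≡ k))
lemma15 k _ i _ i≤k = size≤ , mk⇔ equal-size⇒i≡k (cong (λ n → size (mu k n)))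
  where
  j = k ∸ i
  i+j≡k : i + j ≡ k
  i+j≡k = m+[n∸m]≡n i≤k
  comparison = gap-conclusion k j (suc (3 * i + j)) (size-difference k i j i+j≡k)
  size≤ = proj₁ comparison
  equal-size⇒i≡k : size (mu k i) ≡ size (mu k k) → i ≡ k
  equal-size⇒i≡k equal = trans (sym (+-identityʳ i))
                               (trans (cong (i +_) (sym (proj₂ comparison equal))) i+j≡k)
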